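{- Let $q$ be a prime power, $n\ge1$, $G=\mathbb{F}_q$ and $H=\mathbb{F}_q^n$, and let $k\ge2$ be an integer. If $f:G\to H$ passes $\mathsf{Test\_NonZero}_k(f)$ with probability $\delta_k$, then \[\Bigl(1-\frac1q\Bigr)\delta_k^{\frac{1}{k-1}} \le \max_{\varphi}\mathrm{agr}(f,\varphi)\le \frac1q+\frac{q-1}{q}\,\delta_k^{\frac1k},\] where the maximum is over all $\mathbb{F}_q$-linear maps $\varphi:\mathbb{F}_q\to\mathbb{F}_q^n$.
   Context: $\mathrm{agr}(f,\varphi)=\Pr_{x\sim\mathbb{F}_q}[f(x)=\varphi(x)]$, $x$ uniform in $\mathbb{F}_q$. The $\mathbb{F}_q$-linear maps $\mathbb{F}_q\to\mathbb{F}_q^n$ are the maps $x\mapsto xv$ for $v\in\mathbb{F}_q^n$. $\mathsf{Test\_NonZero}_k(f)$: sample $(x_1,\dots,x_k)$ uniformly from $(\mathbb{F}_q\setminus\{0\})^k$; accept iff $x_i^{ -1}f(x_i)=x_j^{ -1}f(x_j)$ for all $i,j\in[k]$ (equivalently, iff there is an $\mathbb{F}_q$-linear $\varphi$ with $f(x_i)=\varphi(x_i)$ for all $i$). -}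

module Defs where

open import Level using (0ℓ)
open import Data.Nat using (ℕ; zero; suc; _⊔_)
open import Data.Fin using (Fin)
open import Data.Bool using (Bool; true; false; _∧_; not)
open import Data.List using (List; []; _∷_; map; filter; length; concatMap; foldr; allFin)
open import Data.Vec using (Vec; []; _∷_; lookup)
import Data.Vec as Vec
import Data.Vec.Properties as VecP
open import Function.Bundles using (_↔_; Inverse)
open import Relation.Nullary using (¬_; does; ¬?)
open import Relation.Nullary.Decidable using (T?)
open import Relation.Binary.Definitions using (DecidableEquality)
open import Relation.Binary.PropositionalEquality using (_≡_)
open import Algebra.Structures using (IsCommutativeRing)

-- Every finite field has prime-power order and every prime power q occurs,
-- so quantifying over these records is quantifying over "F_q, q a prime power".
record FiniteField (q : ℕ) : Set₁ where
  infixl 7 _*_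
  infixl 6 _+_
  field
    F       : Set
    _+_ _*_ : F → F → F
    -_      : F → F
    0# 1#   : F
    isCommutativeRing : IsCommutativeRing _≡_ _+_ _*_ -_ 0# 1#
    0≢1     : ¬ (0# ≡ 1#)
    _⁻¹     : F → F
    ⁻¹-inverse : ∀ x → ¬ (x ≡ 0#) → x * (x ⁻¹) ≡ 1#
    _≟_     : DecidableEquality F
    enum    : Fin q ↔ F

module _ {q : ℕ} (𝔽 : FiniteField q) where
  open FiniteField 𝔽

  elems : List F
  elems = map (Inverse.to enum) (allFin q)

  nonzeros : List F
  nonzeros = filter (λ x → ¬? (x ≟ 0#)) elems

  _·_ : {n : ℕ} → F → Vec F n → Vec F n
  x · v = Vec.map (x *_) v

  tuples : (m : ℕ) → List F → List (Vec F m)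
  tuples zero    xs = [] ∷ []
  tuples (suc m) xs = concatMap (λ x → map (x ∷_) (tuples m xs)) xs

  _≟ᵥ_ : {n : ℕ} → DecidableEquality (Vec F n)
  _≟ᵥ_ = VecP.≡-dec _≟_

  -- number of x ∈ F_q with f x = x v, i.e. q · agr(f, x ↦ x v)
  agrCount : {n : ℕ} → (F → Vec F n) → Vec F n → ℕ
  agrCount f v = length (filter (λ x → f x ≟ᵥ (x · v)) elems)

  -- q · max_φ agr(f, φ), maximum over all F_q-linear φ : x ↦ x v, v ∈ F_q^n
  maxAgrCount : (n : ℕ) → (F → Vec F n) → ℕ
  maxAgrCount n f = foldr _⊔_ 0 (map (agrCount f) (tuples n elems))

  allB : {A : Set} → (A → Bool) → List A → Bool
  allB p = foldr (λ a b → p a ∧ b) true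

  -- acceptance of Test_NonZero_k on the sample (x_1,…,x_k):
  -- x_i⁻¹ f(x_i) = x_j⁻¹ f(x_j) for all i, j ∈ [k]
  accepts : {n : ℕ} (k : ℕ) → (F → Vec F n) → Vec F k → Bool
  accepts k f xs =
    allB (λ i → allB (λ j → does ((((lookup xs i) ⁻¹) · f (lookup xs i))
                                  ≟ᵥ (((lookup xs j) ⁻¹) · f (lookup xs j))))
                   (allFin k))
        (allFin k)

  -- number of accepted samples among the (q-1)^k equally likely ones;
  -- δ_k = acceptCount / (q-1)^k
  acceptCount : {n : ℕ} (k : ℕ) → (F → Vec F n) → ℕ
  acceptCount k f = length (filter (λ xs → T? (accepts k f xs)) (tuples k nonzeros))

-- Every nonzero x ∈ F_q agrees with exactly one linear map, namely x ↦ x s(x) for the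
-- slope s(x) = x⁻¹ f(x), and the test accepts a sample iff all its points have the same
-- slope. Writing c_v for the number of nonzero points of slope v, the acceptance count is
-- T_k = Σ_v c_v^k, while the agreement count of v is c_v or c_v + 1 (the point 0 agrees
-- with every linear map). Hence M - 1 ≤ max c_v and (max c_v)^k ≤ T_k ≤ (q-1) M^(k-1),
-- where M is the maximal agreement count; these are the two bounds.
module Submission where

open import Defs using (FiniteField; elems; nonzeros; tuples; agrCount; maxAgrCount; allB; accepts; acceptCount)
import Defs
open import Level using (Level)
open import Algebra.Structures using (IsCommutativeRing)
open import Algebra.Properties.CommutativeSemigroup using (x∙yz≈z∙yx)
open import Data.Bool using (Bool; T)
open import Data.Bool.Properties using (T-∧)
open import Data.Fin using (Fin; zero; suc)
import Data.Fin.Properties as Fin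
open import Data.List using (List; []; _∷_; [_]; _++_; map; filter; length; concatMap; foldr; tabulate; allFin)
open import Data.List.Properties using (filter-++; length-++; filter-accept; filter-reject; filter-none; filter-≐; map-tabulate; length-map; length-tabulate; foldr-preservesᵇ)
open import Data.List.Relation.Unary.All as All using (All; []; _∷_)
open import Data.List.Relation.Unary.All.Properties using (tabulate⁺; tabulate⁻; map⁺)
open import Data.List.Relation.Unary.Any as Any using (here; there)
open import Data.List.Membership.Propositional using (_∈_)
open import Data.List.Membership.Propositional.Properties using (∈-map⁺; ∈-concatMap⁺; ∈-allFin)
open import Data.Nat using (ℕ; zero; suc; _+_; _*_; _^_; _∸_; _⊔_; _≤_; z≤n; s≤s)
open import Data.Nat.Properties using (≤-trans; ≤-reflexive; n≤1+n; m≤n⇒m≤1+n; +-suc; +-identityʳ; +-mono-≤; +-monoʳ-≤; *-comm; *-distribʳ-+; *-monoʳ-≤; *-commutativeSemigroup; ^-monoˡ-≤; m+n∸n≡m; m≤n+o⇒m∸n≤o; ⊔-sel; m≤m⊔n; m≤n⇒m≤o⊔n; module ≤-Reasoning)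
open import Data.Product using (_×_; _,_)
open import Data.Sum using (_⊎_; inj₁; inj₂; [_,_]′)
open import Data.Unit using (tt)
open import Data.Vec using (Vec; []; _∷_; lookup)
import Data.Vec as Vec
import Data.Vec.Properties as Vec
open import Data.Vec.Relation.Unary.All as VecAll using (all?; _∷_)
open import Data.Vec.Relation.Unary.All.Properties using (lookup⁺; lookup⁻)
open import Function using (_∘_; id; const)
open import Function.Bundles using (_⇔_; mk⇔; Equivalence; Inverse; Injection)
open import Function.Definitions using (Injective)
open import Function.Properties.Inverse using (↔⇒↣)
open import Relation.Binary.Definitions using (DecidableEquality)
open import Relation.Binary.PropositionalEquality using (_≡_; _≢_; refl; sym; trans; cong; cong₂; subst; module ≡-Reasoning)
open import Relation.Nullary using (Dec; yes; no; does; ¬_; contradiction)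
open import Relation.Nullary.Decidable using (T?)
open import Relation.Unary using (Pred; Decidable; _⊆_)
open import Relation.Unary.Properties using (_∪?_; _∩?_; ∁?)

private variable
  a ℓ ℓ₁ : Level
  A B : Set a

count : {P : Pred A ℓ} → Decidable P → List A → ℕ
count P? xs = length (filter P? xs)

T-does : {P : Set ℓ} (P? : Dec P) → T (does P?) ⇔ P
T-does (yes p) = mk⇔ (const p) (const tt)
T-does (no ¬p) = mk⇔ (λ ()) ¬p

module _ {P : Pred A ℓ} (P? : Decidable P) where

  count-++ : ∀ xs ys → count P? (xs ++ ys) ≡ count P? xs + count P? ys
  count-++ xs ys = trans (cong length (filter-++ P? xs ys)) (length-++ (filter P? xs))

  count-∁ : ∀ xs → count (∁? P?) xs + count P? xs ≡ length xs
  count-∁ []       = refl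
  count-∁ (x ∷ xs) with P? x
  ... | yes _ = trans (+-suc _ _) (cong suc (count-∁ xs))
  ... | no  _ = cong suc (count-∁ xs)

  count-map : (f : B → A) → ∀ xs → count P? (map f xs) ≡ count (P? ∘ f) xs
  count-map f []       = refl
  count-map f (x ∷ xs) with P? (f x)
  ... | yes _ = cong suc (count-map f xs)
  ... | no  _ = count-map f xs

  count-concatMap-≤ : (h : B → List A) {C : ℕ} → (∀ x → count P? (h x) ≤ C) →
                      ∀ xs → count P? (concatMap h xs) ≤ length xs * C
  count-concatMap-≤ h         bound []       = z≤n
  count-concatMap-≤ h {C = C} bound (x ∷ xs) = begin
    count P? (h x ++ concatMap h xs)          ≡⟨ count-++ (h x) (concatMap h xs) ⟩
    count P? (h x) + count P? (concatMap h xs) ≤⟨ +-mono-≤ (bound x) (count-concatMap-≤ h bound xs) ⟩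
    C + length xs * C                          ∎
    where open ≤-Reasoning

  module _ {Q : Pred A ℓ₁} (Q? : Decidable Q) where

    count-mono : P ⊆ Q → ∀ xs → count P? xs ≤ count Q? xs
    count-mono P⊆Q []       = z≤n
    count-mono P⊆Q (x ∷ xs) with P? x | Q? x
    ... | yes _  | yes _  = s≤s (count-mono P⊆Q xs)
    ... | yes px | no ¬qx = contradiction (P⊆Q px) ¬qx
    ... | no  _  | yes _  = m≤n⇒m≤1+n (count-mono P⊆Q xs)
    ... | no  _  | no  _  = count-mono P⊆Q xs

    count-filter : ∀ xs → count Q? (filter P? xs) ≡ count (P? ∩? Q?) xs
    count-filter []       = refl
    count-filter (x ∷ xs) with P? x
    ... | no  _ = count-filter xs
    ... | yes _ with Q? x
    ...   | yes _ = cong suc (count-filter xs)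
    ...   | no  _ = count-filter xs

    count-∪ : ∀ xs → count (P? ∪? Q?) xs ≤ count P? xs + count Q? xs
    count-∪ []       = z≤n
    count-∪ (x ∷ xs) with P? x | Q? x
    ... | yes _ | yes _ = s≤s (≤-trans (count-∪ xs) (+-monoʳ-≤ _ (n≤1+n _)))
    ... | yes _ | no  _ = s≤s (count-∪ xs)
    ... | no  _ | yes _ = ≤-trans (s≤s (count-∪ xs)) (≤-reflexive (sym (+-suc _ _)))
    ... | no  _ | no  _ = count-∪ xs

count-≟-tabulate : (_≟_ : DecidableEquality A) {n : ℕ} (h : Fin n → A) → Injective _≡_ _≡_ h →
                   ∀ i → count (_≟ h i) (tabulate h) ≡ 1
count-≟-tabulate _≟_ h h-inj zero = cong length (begin
  filter (_≟ h zero) (tabulate h)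
    ≡⟨ filter-accept (_≟ h zero) refl ⟩
  h zero ∷ filter (_≟ h zero) (tabulate (h ∘ suc))
    ≡⟨ cong (h zero ∷_) (filter-none (_≟ h zero) h∘suc≢h0) ⟩
  h zero ∷ []
    ∎)
  where
  open ≡-Reasoning
  h∘suc≢h0 : All (¬_ ∘ (_≡ h zero)) (tabulate (h ∘ suc))
  h∘suc≢h0 = tabulate⁺ (λ j → Fin.0≢1+n ∘ sym ∘ h-inj)
count-≟-tabulate _≟_ h h-inj (suc i) = begin
  count (_≟ h (suc i)) (tabulate h)
    ≡⟨ cong length (filter-reject (_≟ h (suc i)) (Fin.0≢1+n ∘ h-inj)) ⟩
  count (_≟ h (suc i)) (tabulate (h ∘ suc))
    ≡⟨ count-≟-tabulate _≟_ (h ∘ suc) (Fin.suc-injective ∘ h-inj) i ⟩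
  1
    ∎
  where open ≡-Reasoning

module _ {P : Pred A ℓ} (P? : Decidable P) where

  count-all-cons : ∀ x {k} (vs : List (Vec A k)) →
                   count (all? P?) (map (x ∷_) vs) ≡ count P? [ x ] * count (all? P?) vs
  count-all-cons x vs with P? x
  ... | yes px = begin
    count (all? P?) (map (x ∷_) vs) ≡⟨ count-map (all? P?) (x ∷_) vs ⟩
    count (all? P? ∘ (x ∷_)) vs      ≡⟨ cong length (filter-≐ _ (all? P?) (VecAll.tail , px ∷_) vs) ⟩
    count (all? P?) vs               ≡⟨ +-identityʳ _ ⟨
    1 * count (all? P?) vs           ∎
    where open ≡-Reasoning
  ... | no ¬px = trans (count-map (all? P?) (x ∷_) vs) (cong length (filter-none (all? P? ∘ (x ∷_)) none))
    where
    none : All (λ v → ¬ VecAll.All P (x ∷ v)) vs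
    none = All.universal (λ _ → ¬px ∘ VecAll.head) vs

  count-all-concatMap-cons : ∀ {k} (vs : List (Vec A k)) xs →
    count (all? P?) (concatMap (λ x → map (x ∷_) vs) xs) ≡ count P? xs * count (all? P?) vs
  count-all-concatMap-cons vs []       = refl
  count-all-concatMap-cons vs (x ∷ xs) = begin
    count (all? P?) (map (x ∷_) vs ++ concatMap (λ y → map (y ∷_) vs) xs)
      ≡⟨ count-++ (all? P?) (map (x ∷_) vs) _ ⟩
    count (all? P?) (map (x ∷_) vs) + count (all? P?) (concatMap (λ y → map (y ∷_) vs) xs)
      ≡⟨ cong₂ _+_ (count-all-cons x vs) (count-all-concatMap-cons vs xs) ⟩
    count P? [ x ] * count (all? P?) vs + count P? xs * count (all? P?) vs
      ≡⟨ *-distribʳ-+ (count (all? P?) vs) (count P? [ x ]) (count P? xs) ⟨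
    (count P? [ x ] + count P? xs) * count (all? P?) vs
      ≡⟨ cong (_* count (all? P?) vs) (count-++ P? [ x ] xs) ⟨
    count P? (x ∷ xs) * count (all? P?) vs
      ∎
    where open ≡-Reasoning

∈⇒≤-foldr-⊔ : (h : A → ℕ) {x : A} {xs : List A} → x ∈ xs → h x ≤ foldr _⊔_ 0 (map h xs)
∈⇒≤-foldr-⊔ h (here refl) = m≤m⊔n _ _
∈⇒≤-foldr-⊔ h (there x∈xs) = m≤n⇒m≤o⊔n _ (∈⇒≤-foldr-⊔ h x∈xs)

foldr-⊔-preserves : (P : Pred ℕ ℓ) → P 0 → (h : A → ℕ) → (∀ x → P (h x)) →
                    ∀ xs → P (foldr _⊔_ 0 (map h xs))
foldr-⊔-preserves P P0 h Ph xs =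
  foldr-preservesᵇ {P = P} ⊔-preserves P0 (map⁺ (All.universal Ph xs))
  where
  ⊔-preserves : ∀ {m n} → P m → P n → P (m ⊔ n)
  ⊔-preserves {m} {n} Pm Pn = [ (λ e → subst P (sym e) Pm) , (λ e → subst P (sym e) Pn) ]′ (⊔-sel m n)

module _ {q : ℕ} (𝔽 : FiniteField q) where
  open FiniteField 𝔽 using (F; 0#; 1#; _⁻¹; ⁻¹-inverse; enum; isCommutativeRing)
    renaming (_*_ to _*ᶠ_; _≟_ to _≟ᶠ_)
  open IsCommutativeRing isCommutativeRing using ()
    renaming (*-assoc to *ᶠ-assoc; *-comm to *ᶠ-comm; *-identityˡ to *ᶠ-identityˡ)

  private
    _·_ : ∀ {m} → F → Vec F m → Vec F m
    _·_ = Defs._·_ 𝔽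

    _≟ᵥ_ : ∀ {m} → DecidableEquality (Vec F m)
    _≟ᵥ_ = Defs._≟ᵥ_ 𝔽

  ·-cancel : ∀ {m} {x y : F} → x *ᶠ y ≡ 1# → (w : Vec F m) → x · (y · w) ≡ w
  ·-cancel {x = x} {y} xy≡1 w = begin
    Vec.map (x *ᶠ_) (Vec.map (y *ᶠ_) w)  ≡⟨ Vec.map-∘ (x *ᶠ_) (y *ᶠ_) w ⟨
    Vec.map (λ z → x *ᶠ (y *ᶠ z)) w      ≡⟨ Vec.map-cong cancel w ⟩
    Vec.map id w                          ≡⟨ Vec.map-id w ⟩
    w                                     ∎
    where
    open ≡-Reasoning
    cancel : ∀ z → x *ᶠ (y *ᶠ z) ≡ z
    cancel z = trans (sym (*ᶠ-assoc x y z)) (trans (cong (_*ᶠ z) xy≡1) (*ᶠ-identityˡ z))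

  isZero? : Decidable (_≡ 0#)
  isZero? x = x ≟ᶠ 0#

  count-isZero-elems : count isZero? (elems 𝔽) ≡ 1
  count-isZero-elems = begin
    count isZero? (map to (allFin q))
      ≡⟨ cong (count isZero?) (map-tabulate id to) ⟩
    count (_≟ᶠ 0#) (tabulate to)
      ≡⟨ cong (λ z → count (_≟ᶠ z) (tabulate to)) (strictlyInverseˡ 0#) ⟨
    count (_≟ᶠ to (from 0#)) (tabulate to)
      ≡⟨ count-≟-tabulate _≟ᶠ_ to (Injection.injective (↔⇒↣ enum)) (from 0#) ⟩
    1
      ∎
    where
    open ≡-Reasoning
    open Inverse enum using (to; from; strictlyInverseˡ)

  length-nonzeros : length (nonzeros 𝔽) ≡ q ∸ 1
  length-nonzeros = begin
    length (nonzeros 𝔽)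
      ≡⟨ m+n∸n≡m _ 1 ⟨
    length (nonzeros 𝔽) + 1 ∸ 1
      ≡⟨ cong (λ z → length (nonzeros 𝔽) + z ∸ 1) count-isZero-elems ⟨
    length (nonzeros 𝔽) + count isZero? (elems 𝔽) ∸ 1
      ≡⟨ cong (_∸ 1) (count-∁ isZero? (elems 𝔽)) ⟩
    length (elems 𝔽) ∸ 1
      ≡⟨ cong (_∸ 1) (trans (length-map _ (allFin q)) (length-tabulate {n = q} id)) ⟩
    q ∸ 1
      ∎
    where open ≡-Reasoning

  ∈-elems : ∀ x → x ∈ elems 𝔽
  ∈-elems x = subst (_∈ elems 𝔽) (strictlyInverseˡ x) (∈-map⁺ to (∈-allFin (from x)))
    where open Inverse enum using (to; from; strictlyInverseˡ)

  ∈-tuples : {xs : List F} → (∀ x → x ∈ xs) → ∀ {m} (v : Vec F m) → v ∈ tuples 𝔽 m xs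
  ∈-tuples complete []      = here refl
  ∈-tuples complete (x ∷ v) = ∈-concatMap⁺ (λ y → map (y ∷_) (tuples 𝔽 _ _))
    (Any.map (λ { refl → ∈-map⁺ (x ∷_) (∈-tuples complete v) }) (complete x))

  count-all-tuples : {P : Pred F ℓ} (P? : Decidable P) → ∀ k xs →
                     count (all? P?) (tuples 𝔽 k xs) ≡ count P? xs ^ k
  count-all-tuples P? zero    xs = refl
  count-all-tuples P? (suc k) xs = trans (count-all-concatMap-cons P? (tuples 𝔽 k xs) xs)
                                         (cong (count P? xs *_) (count-all-tuples P? k xs))

  samples : ∀ k → List (Vec F k)
  samples k = tuples 𝔽 k (nonzeros 𝔽)

  allB⁻ : {p : A → Bool} (xs : List A) → T (allB 𝔽 p xs) → All (T ∘ p) xs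
  allB⁻ []       _ = []
  allB⁻ (x ∷ xs) t = let tx , txs = Equivalence.to T-∧ t in tx ∷ allB⁻ xs txs

  allB⁺ : {p : A → Bool} {xs : List A} → All (T ∘ p) xs → T (allB 𝔽 p xs)
  allB⁺ []         = tt
  allB⁺ (px ∷ pxs) = Equivalence.from T-∧ (px , allB⁺ pxs)

  module _ {n : ℕ} (f : F → Vec F n) where

    slope : F → Vec F n
    slope x = (x ⁻¹) · f x

    onSlope? : (v : Vec F n) → Decidable (λ x → slope x ≡ v)
    onSlope? v x = slope x ≟ᵥ v

    slopeCount : Vec F n → ℕ
    slopeCount v = count (onSlope? v) (nonzeros 𝔽)

    agrees⇒onSlope : ∀ {x v} → x ≢ 0# → f x ≡ x · v → slope x ≡ v
    agrees⇒onSlope {x} {v} x≢0 fx≡xv =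
      trans (cong ((x ⁻¹) ·_) fx≡xv) (·-cancel (trans (*ᶠ-comm _ x) (⁻¹-inverse x x≢0)) v)

    onSlope⇒agrees : ∀ {x v} → x ≢ 0# → slope x ≡ v → f x ≡ x · v
    onSlope⇒agrees {x} x≢0 sx≡v = trans (sym (·-cancel (⁻¹-inverse x x≢0) (f x))) (cong (x ·_) sx≡v)

    agrees? : (v : Vec F n) → Decidable (λ x → f x ≡ x · v)
    agrees? v x = f x ≟ᵥ (x · v)

    slopeCount≤agrCount : ∀ v → slopeCount v ≤ agrCount 𝔽 f v
    slopeCount≤agrCount v = begin
      count (onSlope? v) (nonzeros 𝔽)
        ≡⟨ count-filter (∁? isZero?) (onSlope? v) (elems 𝔽) ⟩
      count (∁? isZero? ∩? onSlope? v) (elems 𝔽)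
        ≤⟨ count-mono _ (agrees? v) (λ (x≢0 , sx≡v) → onSlope⇒agrees x≢0 sx≡v) (elems 𝔽) ⟩
      agrCount 𝔽 f v
        ∎
      where open ≤-Reasoning

    agrCount≤1+slopeCount : ∀ v → agrCount 𝔽 f v ≤ 1 + slopeCount v
    agrCount≤1+slopeCount v = begin
      count (agrees? v) (elems 𝔽)
        ≤⟨ count-mono _ _ split (elems 𝔽) ⟩
      count (isZero? ∪? (∁? isZero? ∩? onSlope? v)) (elems 𝔽)
        ≤⟨ count-∪ isZero? _ (elems 𝔽) ⟩
      count isZero? (elems 𝔽) + count (∁? isZero? ∩? onSlope? v) (elems 𝔽)
        ≡⟨ cong₂ _+_ count-isZero-elems (sym (count-filter _ _ (elems 𝔽))) ⟩
      1 + slopeCount v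
        ∎
      where
      open ≤-Reasoning
      split : ∀ {x} → f x ≡ x · v → x ≡ 0# ⊎ (x ≢ 0# × slope x ≡ v)
      split {x} fx≡xv with isZero? x
      ... | yes x≡0 = inj₁ x≡0
      ... | no  x≢0 = inj₂ (x≢0 , agrees⇒onSlope x≢0 fx≡xv)

    agrCount≤maxAgrCount : ∀ v → agrCount 𝔽 f v ≤ maxAgrCount 𝔽 n f
    agrCount≤maxAgrCount v = ∈⇒≤-foldr-⊔ (agrCount 𝔽 f) (∈-tuples ∈-elems v)

    accepts⁻ : ∀ {k} (xs : Vec F k) → T (accepts 𝔽 k f xs) →
               ∀ i j → slope (lookup xs i) ≡ slope (lookup xs j)
    accepts⁻ {k} xs accepted i j =
      Equivalence.to (T-does (slope (lookup xs i) ≟ᵥ slope (lookup xs j)))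
        (tabulate⁻ (allB⁻ (allFin k) (tabulate⁻ (allB⁻ (allFin k) accepted) i)) j)

    accepts⁺ : ∀ {k} (xs : Vec F k) → (∀ i j → slope (lookup xs i) ≡ slope (lookup xs j)) →
               T (accepts 𝔽 k f xs)
    accepts⁺ xs equal = allB⁺ (tabulate⁺ λ i → allB⁺ (tabulate⁺ λ j →
      Equivalence.from (T-does (slope (lookup xs i) ≟ᵥ slope (lookup xs j))) (equal i j)))

    accepts-cons⇒onSlope : ∀ {k} x (xs : Vec F k) → T (accepts 𝔽 (suc k) f (x ∷ xs)) →
                           VecAll.All (λ y → slope y ≡ slope x) xs
    accepts-cons⇒onSlope x xs accepted = lookup⁻ (λ j → accepts⁻ (x ∷ xs) accepted (suc j) zero)

    onSlope⇒accepts : ∀ {k v} (xs : Vec F k) → VecAll.All (λ y → slope y ≡ v) xs →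
                      T (accepts 𝔽 k f xs)
    onSlope⇒accepts xs onSlope =
      accepts⁺ xs (λ i j → trans (lookup⁺ onSlope i) (sym (lookup⁺ onSlope j)))

    accepts? : ∀ k → Decidable (λ xs → T (accepts 𝔽 k f xs))
    accepts? k xs = T? (accepts 𝔽 k f xs)

    acceptCount-lower : ∀ k v → slopeCount v ^ k ≤ acceptCount 𝔽 k f
    acceptCount-lower k v = begin
      slopeCount v ^ k
        ≡⟨ count-all-tuples (onSlope? v) k (nonzeros 𝔽) ⟨
      count (all? (onSlope? v)) (samples k)
        ≤⟨ count-mono (all? (onSlope? v)) (accepts? k) (λ {xs} → onSlope⇒accepts xs) (samples k) ⟩
      acceptCount 𝔽 k f
        ∎
      where open ≤-Reasoning

    acceptCount-upper : ∀ k → acceptCount 𝔽 (suc k) f ≤ length (nonzeros 𝔽) * maxAgrCount 𝔽 n f ^ k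
    acceptCount-upper k = count-concatMap-≤ (accepts? (suc k)) _ startingAt (nonzeros 𝔽)
      where
      open ≤-Reasoning
      startingAt : ∀ x → count (accepts? (suc k)) (map (x ∷_) (samples k)) ≤ maxAgrCount 𝔽 n f ^ k
      startingAt x = begin
        count (accepts? (suc k)) (map (x ∷_) (samples k))
          ≡⟨ count-map (accepts? (suc k)) (x ∷_) (samples k) ⟩
        count (accepts? (suc k) ∘ (x ∷_)) (samples k)
          ≤⟨ count-mono (accepts? (suc k) ∘ (x ∷_)) (all? (onSlope? (slope x)))
                        (λ {xs} → accepts-cons⇒onSlope x xs) (samples k) ⟩
        count (all? (onSlope? (slope x))) (samples k)
          ≡⟨ count-all-tuples (onSlope? (slope x)) k (nonzeros 𝔽) ⟩
        slopeCount (slope x) ^ k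
          ≤⟨ ^-monoˡ-≤ k (≤-trans (slopeCount≤agrCount (slope x)) (agrCount≤maxAgrCount (slope x))) ⟩
        maxAgrCount 𝔽 n f ^ k
          ∎

    pred-maxAgrCount^≤acceptCount : ∀ k → (maxAgrCount 𝔽 n f ∸ 1) ^ suc k ≤ acceptCount 𝔽 (suc k) f
    pred-maxAgrCount^≤acceptCount k =
      foldr-⊔-preserves (λ m → (m ∸ 1) ^ suc k ≤ acceptCount 𝔽 (suc k) f) z≤n
                        (agrCount 𝔽 f) bound (tuples 𝔽 n (elems 𝔽))
      where
      bound : ∀ v → (agrCount 𝔽 f v ∸ 1) ^ suc k ≤ acceptCount 𝔽 (suc k) f
      bound v = ≤-trans (^-monoˡ-≤ (suc k) (m≤n+o⇒m∸n≤o _ 1 (agrCount≤1+slopeCount v)))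
                        (acceptCount-lower (suc k) v)

theorem4p11 : (q : ℕ) (𝔽 : FiniteField q) (n : ℕ) → 1 ≤ n → (k : ℕ) → 2 ≤ k →
    (f : FiniteField.F 𝔽 → Vec (FiniteField.F 𝔽) n) →
      ((q ∸ 1) ^ (k ∸ 1) * acceptCount 𝔽 k f
          ≤ maxAgrCount 𝔽 n f ^ (k ∸ 1) * (q ∸ 1) ^ k)
    × ((maxAgrCount 𝔽 n f ∸ 1) ^ k * (q ∸ 1) ^ k
          ≤ (q ∸ 1) ^ k * acceptCount 𝔽 k f)
theorem4p11 q 𝔽 n _ (suc k) _ f = lower , upper
  where
  open ≤-Reasoning
  N M accepted : ℕ
  N        = q ∸ 1
  M        = maxAgrCount 𝔽 n f
  accepted = acceptCount 𝔽 (suc k) f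

  lower : N ^ k * accepted ≤ M ^ k * N ^ suc k
  lower = begin
    N ^ k * accepted                      ≤⟨ *-monoʳ-≤ (N ^ k) (acceptCount-upper 𝔽 f k) ⟩
    N ^ k * (length (nonzeros 𝔽) * M ^ k) ≡⟨ cong (λ z → N ^ k * (z * M ^ k)) (length-nonzeros 𝔽) ⟩
    N ^ k * (N * M ^ k)                   ≡⟨ x∙yz≈z∙yx *-commutativeSemigroup (N ^ k) N (M ^ k) ⟩
    M ^ k * N ^ suc k                     ∎

  upper : (M ∸ 1) ^ suc k * N ^ suc k ≤ N ^ suc k * accepted
  upper = begin
    (M ∸ 1) ^ suc k * N ^ suc k ≡⟨ *-comm ((M ∸ 1) ^ suc k) (N ^ suc k) ⟩
    N ^ suc k * (M ∸ 1) ^ suc k ≤⟨ *-monoʳ-≤ (N ^ suc k) (pred-maxAgrCount^≤acceptCount 𝔽 f k) ⟩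
    N ^ suc k * accepted        ∎
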